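{- Let $G$ be a digraph such that $\mathrm{wcol}_\infty(G)\leq c$ for some constant $c$. Then $G$ does not contain a directed path of length greater than $2^c-2$, and every directed topological minor $H$ of $G$ satisfies $|E(H)|/|V(H)|\leq 4c$.
   Context: Weak coloring numbers: for a linear order $L$ of $V(G)$ and $r\ge0$, $u$ is weakly $r$-reachable from $v$ if there is a directed path $P$ of length at most $r$ between $u$ and $v$ (directed either way) with $u$ the $L$-minimum vertex of $P$; $\mathrm{WReach}_r[G,L,v]$ is the set of such $u$ (including $v$); $\mathrm{wcol}_r(G)=\min_L\max_v|\mathrm{WReach}_r[G,L,v]|$. For an $n$-vertex digraph $G$, $\mathrm{wcol}_\infty(G):=\mathrm{wcol}_n(G)$. A digraph $H$ is a directed topological minor of $G$ if there is an injective map $\delta$ from $V(H)$ to $V(G)$ and a map sending each arc $e=(u,v)\in E(H)$ to a directed path $\delta(e)$ in $G$ from $\delta(u)$ to $\delta(v)$, such that each $\delta(e)$ is internally vertex-disjoint from all vertices $\delta(w)$, $w\in V(H)$, and from all other paths $\delta(e')$, $e'\ne e$. -}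

module Defs where

open import Data.Nat using (ℕ; zero; suc; _+_; _*_; _≤_; _<_)
open import Data.Fin using (Fin; toℕ; inject₁) renaming (zero to fzero; suc to fsuc)
open import Data.Fin.Subset using (Subset; _∈_; ∣_∣)
open import Data.Bool using (Bool; true; false; if_then_else_)
open import Data.List using (List; map; allFin)
open import Data.Nat.ListAction using (sum)
open import Data.Product using (Σ; ∃; ∃-syntax; _×_; _,_)
open import Data.Sum using (_⊎_)
open import Relation.Binary.PropositionalEquality using (_≡_; _≢_)
open import Relation.Nullary using (¬_)
open import Function.Definitions using (Injective)
open import Function.Bundles using (_⇔_)

record Digraph (n : ℕ) : Set where
  field
    arc      : Fin n → Fin n → Bool
    loopless : ∀ v → arc v v ≡ false
open Digraph public

record DPath {n : ℕ} (G : Digraph n) (k : ℕ) : Set where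
  field
    vtx      : Fin (suc k) → Fin n
    distinct : Injective _≡_ _≡_ vtx
    arcs     : ∀ (i : Fin k) → arc G (vtx (inject₁ i)) (vtx (fsuc i)) ≡ true
open DPath public

start : ∀ {n k} {G : Digraph n} → DPath G k → Fin n
start P = vtx P fzero

finish : ∀ {n k} {G : Digraph n} → DPath G k → Fin n
finish {k = k} P = vtx P (Data.Fin.fromℕ k)

OnPath : ∀ {n k} {G : Digraph n} → DPath G k → Fin n → Set
OnPath P x = ∃[ i ] vtx P i ≡ x

Internal : ∀ {n k} {G : Digraph n} → DPath G k → Fin n → Set
Internal {k = k} P x = ∃[ i ] (toℕ i ≢ 0 × toℕ i ≢ k × vtx P i ≡ x)

-- A linear order on Fin n, encoded by an injective rank function
-- (u <_L v  iff  rank u < rank v).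
record LinOrder (n : ℕ) : Set where
  field
    rank  : Fin n → Fin n
    rank-inj : Injective _≡_ _≡_ rank
open LinOrder public

IsMinOn : ∀ {n k} {G : Digraph n} → LinOrder n → DPath G k → Fin n → Set
IsMinOn L P u = OnPath P u × (∀ i → toℕ (rank L u) ≤ toℕ (rank L (vtx P i)))

-- u ∈ WReach_r[G, L, v]: there is a directed path P of length at most r
-- between u and v (in either direction) with u the L-minimum of P.
-- (For u = v the path of length 0 witnesses v ∈ WReach_r[G,L,v].)
WReach : ∀ {n} → (G : Digraph n) → LinOrder n → ℕ → Fin n → Fin n → Set
WReach G L r v u =
  ∃[ k ] (k ≤ r × Σ (DPath G k) λ P →
     (((start P ≡ u × finish P ≡ v) ⊎ (start P ≡ v × finish P ≡ u))
      × IsMinOn L P u))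

-- |WReach_r[G,L,v]| ≤ c : the set WReach_r[G,L,v] is (given by) a subset
-- of Fin n of cardinality at most c.
WReachSizeLe : ∀ {n} → (G : Digraph n) → LinOrder n → ℕ → Fin n → ℕ → Set
WReachSizeLe {n} G L r v c =
  ∃[ S ] ((∀ u → (u ∈ S) ⇔ WReach G L r v u) × ∣_∣ {n} S ≤ c)

-- wcol_r(G) ≤ c  (unfolding of  min_L max_v |WReach_r[G,L,v]| ≤ c)
WcolLe : ∀ {n} → Digraph n → ℕ → ℕ → Set
WcolLe {n} G r c = ∃[ L ] (∀ v → WReachSizeLe G L r v c)

-- wcol_∞(G) ≤ c, where wcol_∞(G) := wcol_n(G) for an n-vertex digraph
WcolInfLe : ∀ {n} → Digraph n → ℕ → Set
WcolInfLe {n} G c = WcolLe G n c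

arcCount : ∀ {m} → Digraph m → ℕ
arcCount {m} H =
  sum (map (λ a → sum (map (λ b → if arc H a b then 1 else 0) (allFin m)))
           (allFin m))

record TopMinorModel {m n : ℕ} (H : Digraph m) (G : Digraph n) : Set where
  field
    δ       : Fin m → Fin n
    δ-inj   : Injective _≡_ _≡_ δ
    len     : (a b : Fin m) → arc H a b ≡ true → ℕ
    path    : (a b : Fin m) (e : arc H a b ≡ true) → DPath G (len a b e)
    path-start : ∀ a b e → start (path a b e) ≡ δ a
    path-end   : ∀ a b e → finish (path a b e) ≡ δ b
    avoid-branch : ∀ a b e x w → Internal (path a b e) x → x ≢ δ w
    avoid-paths : ∀ a b e a' b' e' → ¬ (a ≡ a' × b ≡ b') → ∀ x →
                  Internal (path a b e) x → ¬ OnPath (path a' b' e') x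

IsDirTopMinor : ∀ {m n} → Digraph m → Digraph n → Set
IsDirTopMinor H G = TopMinorModel H G

module Submission where

open import Defs
open import Data.Nat using (ℕ; _≤_; _*_; _^_; _∸_)
open import Data.Product using (_×_)

open import Data.Nat using (zero; suc; _+_; _<_; _<ᵇ_; z≤n; s≤s; _≤?_)
open import Data.Nat.Properties
open import Data.Nat.Tactic.RingSolver using (solve-∀)
open import Data.Fin as Fin using (Fin; toℕ; inject₁; fromℕ; fromℕ<) renaming (zero to fzero; suc to fsuc)
open import Data.Fin.Properties using (toℕ-injective; toℕ-fromℕ; toℕ-inject₁; toℕ-fromℕ<; toℕ<n; toℕ≤pred[n]; injective⇒≤)
open import Data.Fin.Subset using (Subset; _-_; ∣_∣) renaming (_∈_ to _∈ˢ_)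
open import Data.Fin.Subset.Properties using (x∈p∧x≢y⇒x∈p-y; x∈p⇒∣p-x∣<∣p∣)
open import Data.Bool using (Bool; true; false; if_then_else_; _∧_)
open import Data.Bool.Properties using (T-≡)
open import Data.List using (List; []; _∷_; map; allFin; length)
open import Data.List.Properties using (length-tabulate)
open import Data.Nat.ListAction using (sum)
open import Data.List.Membership.Propositional using (_∈_)
open import Data.List.Relation.Unary.Any using (here; there)
open import Data.List.Relation.Unary.All as All using (All; []; _∷_)
open import Data.List.Relation.Unary.AllPairs using ([]; _∷_)
open import Data.List.Relation.Unary.Unique.Propositional using (Unique)
open import Data.List.Relation.Unary.Unique.Propositional.Properties using (allFin⁺)
open import Data.Product using (∃-syntax; _,_; proj₁; proj₂)
open import Data.Sum using (_⊎_; inj₁; inj₂)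
open import Data.Empty using (⊥; ⊥-elim)
open import Relation.Nullary using (yes; no)
open import Relation.Nullary.Decidable using (decidable-stable; _×-dec_)
open import Relation.Binary.PropositionalEquality
open import Relation.Binary.Definitions using (tri<; tri≈; tri>)
open import Function.Bundles using (Equivalence)

-- Central observation: if a vertex u is the L-minimum of a stretch P[lo..hi] of a
-- directed path P, then u is weakly reachable from both ends of the stretch (the
-- subpaths P[lo..u] and P[u..hi] witness it).
--
-- Take the minimum x of P[lo..hi], keep the longer of the two sides of x and
-- recurse.  The vertex p where the recursion ends weakly reaches all the minima chosen
-- on the way, and each step at most halves the number of vertices, so a path of length
-- k yields ≥ log₂(k+2) vertices in WReach[p]; hence k + 2 ≤ 2^c.
--
-- For an arc a → b of H let ℓ(a,b) be the L-minimum of its model path; it is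
-- weakly reachable from δa and δb.  If δb <_L δa, the map b ↦ ℓ(a,b) is injective
-- (ℓ(a,b) is δb or internal to a single model path), so a has ≤ c such out-arcs;
-- symmetrically every b has ≤ c in-arcs with δa <_L δb.  Summing gives |E(H)| ≤ 2cm.

ind : Bool → ℕ
ind b = if b then 1 else 0

sumOver : {A : Set} → List A → (A → ℕ) → ℕ
sumOver xs f = sum (map f xs)

sumOver-mono : {A : Set} (xs : List A) {f g : A → ℕ} →
  (∀ x → f x ≤ g x) → sumOver xs f ≤ sumOver xs g
sumOver-mono []       f≤g = z≤n
sumOver-mono (x ∷ xs) f≤g = +-mono-≤ (f≤g x) (sumOver-mono xs f≤g)

sumOver-+ : {A : Set} (xs : List A) (f g : A → ℕ) →
  sumOver xs (λ x → f x + g x) ≡ sumOver xs f + sumOver xs g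
sumOver-+ []       f g = refl
sumOver-+ (x ∷ xs) f g = begin
  f x + g x + sumOver xs (λ x → f x + g x)   ≡⟨ cong (f x + g x +_) (sumOver-+ xs f g) ⟩
  f x + g x + (sumOver xs f + sumOver xs g)  ≡⟨ shuffle (f x) (g x) (sumOver xs f) (sumOver xs g) ⟩
  f x + sumOver xs f + (g x + sumOver xs g)  ∎
  where
  open ≡-Reasoning
  shuffle : ∀ a b c d → a + b + (c + d) ≡ a + c + (b + d)
  shuffle = solve-∀

sumOver-zero : {A : Set} (xs : List A) → sumOver xs (λ _ → 0) ≡ 0
sumOver-zero []       = refl
sumOver-zero (x ∷ xs) = sumOver-zero xs

sumOver-swap : {A B : Set} (xs : List A) (ys : List B) (f : A → B → ℕ) →
  sumOver xs (λ a → sumOver ys (f a)) ≡ sumOver ys (λ b → sumOver xs (λ a → f a b))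
sumOver-swap []       ys f = sym (sumOver-zero ys)
sumOver-swap (x ∷ xs) ys f =
  trans (cong (sumOver ys (f x) +_) (sumOver-swap xs ys f))
        (sym (sumOver-+ ys (f x) (λ b → sumOver xs (λ a → f a b))))

sumOver-≤-length* : {A : Set} (xs : List A) (f : A → ℕ) (c : ℕ) →
  (∀ x → f x ≤ c) → sumOver xs f ≤ length xs * c
sumOver-≤-length* []       f c f≤c = z≤n
sumOver-≤-length* (x ∷ xs) f c f≤c = +-mono-≤ (f≤c x) (sumOver-≤-length* xs f c f≤c)

sumOver-ones : {A : Set} (xs : List A) → sumOver xs (λ _ → 1) ≡ length xs
sumOver-ones []       = refl
sumOver-ones (x ∷ xs) = cong suc (sumOver-ones xs)

count-marked : ∀ {n} {A : Set} (S : Subset n) (p : A → Bool)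
  (g : (x : A) → p x ≡ true → Fin n) (xs : List A) → Unique xs →
  (∀ {x y} → x ∈ xs → y ∈ xs → (px : p x ≡ true) (py : p y ≡ true) →
     g x px ≡ g y py → x ≡ y) →
  (∀ {x} → x ∈ xs → (px : p x ≡ true) → g x px ∈ˢ S) →
  sumOver xs (λ x → ind (p x)) ≤ ∣ S ∣
count-marked S p g []       _               _   _   = z≤n
count-marked S p g (x ∷ xs) (x∉xs ∷ unique) inj mem with p x in px
... | false = count-marked S p g xs unique (λ x∈ y∈ → inj (there x∈) (there y∈))
                (λ y∈ → mem (there y∈))
... | true  = ≤-trans (s≤s rest) (x∈p⇒∣p-x∣<∣p∣ (mem (here refl) px))
  where
  rest : sumOver xs (λ y → ind (p y)) ≤ ∣ S - g x px ∣
  rest = count-marked (S - g x px) p g xs unique (λ x∈ y∈ → inj (there x∈) (there y∈))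
    (λ {y} y∈ py → x∈p∧x≢y⇒x∈p-y (mem (there y∈) py)
       (λ gy≡gx → All.lookup x∉xs y∈ (inj (here refl) (there y∈) px py (sym gy≡gx))))

<ᵇ-true : ∀ {u v} → u < v → (u <ᵇ v) ≡ true
<ᵇ-true u<v = Equivalence.to T-≡ (<⇒<ᵇ u<v)

∧-<ᵇ-true : ∀ x {u v} → x ∧ (u <ᵇ v) ≡ true → x ≡ true × u < v
∧-<ᵇ-true true {u} {v} u<ᵇv = refl , <ᵇ⇒< u v (Equivalence.from T-≡ u<ᵇv)

ind-split : ∀ x {u v} → (x ≡ true → u ≢ v) →
  ind x ≤ ind (x ∧ (v <ᵇ u)) + ind (x ∧ (u <ᵇ v))
ind-split false _  = z≤n
ind-split true {u} {v} u≢v with <-cmp u v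
... | tri< u<v _ _ rewrite <ᵇ-true u<v = m≤n+m 1 (ind (v <ᵇ u))
... | tri> _ _ v<u rewrite <ᵇ-true v<u = s≤s z≤n
... | tri≈ _ u≡v _ = ⊥-elim (u≢v refl u≡v)

IsArgMin : (ℕ → ℕ) → ℕ → ℕ → ℕ → Set
IsArgMin f lo hi q = lo ≤ q × q ≤ hi × (∀ j → lo ≤ j → j ≤ hi → f q ≤ f j)

argmin-point : (f : ℕ → ℕ) (q : ℕ) → IsArgMin f q q q
argmin-point f q = ≤-refl , ≤-refl , λ j q≤j j≤q → ≤-reflexive (cong f (≤-antisym q≤j j≤q))

argmin-shrink : ∀ {f lo hi lo′ hi′ q} → lo ≤ lo′ → hi′ ≤ hi → lo′ ≤ q → q ≤ hi′ →
  IsArgMin f lo hi q → IsArgMin f lo′ hi′ q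
argmin-shrink lo≤lo′ hi′≤hi lo′≤q q≤hi′ (_ , _ , min) =
  lo′≤q , q≤hi′ , λ j lo′≤j j≤hi′ → min j (≤-trans lo≤lo′ lo′≤j) (≤-trans j≤hi′ hi′≤hi)

argmin : (f : ℕ → ℕ) (lo hi : ℕ) → lo ≤ hi → ∃[ q ] IsArgMin f lo hi q
argmin f lo zero    z≤n  = zero , argmin-point f zero
argmin f lo (suc hi) lo≤ with m≤n⇒m<n∨m≡n lo≤
... | inj₂ refl = suc hi , argmin-point f (suc hi)
... | inj₁ (s≤s lo≤hi) with argmin f lo hi lo≤hi
...   | q , lo≤q , q≤hi , min with f q ≤? f (suc hi)
...     | yes fq≤ = q , lo≤q , m≤n⇒m≤1+n q≤hi , extended
  where
  extended : ∀ j → lo ≤ j → j ≤ suc hi → f q ≤ f j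
  extended j lo≤j j≤ with m≤n⇒m<n∨m≡n j≤
  ... | inj₁ (s≤s j≤hi) = min j lo≤j j≤hi
  ... | inj₂ refl       = fq≤
...     | no fq≰ = suc hi , lo≤ , ≤-refl , extended
  where
  extended : ∀ j → lo ≤ j → j ≤ suc hi → f (suc hi) ≤ f j
  extended j lo≤j j≤ with m≤n⇒m<n∨m≡n j≤
  ... | inj₁ (s≤s j≤hi) = ≤-trans (<⇒≤ (≰⇒> fq≰)) (min j lo≤j j≤hi)
  ... | inj₂ refl       = ≤-refl

-- For the minimum x of [lo, hi], 2x ≤ hi + lo says that the part
-- right of x is at least as long as the part left of x; keeping the longer part loses
-- at most half of the vertices (the invariant is  hi + 2 ≤ 2^t + lo).

right-part-nonempty : ∀ {x lo hi} → 2 * x ≤ hi + lo → lo < hi → x < hi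
right-part-nonempty {x} {lo} {hi} 2x≤ lo<hi = ≰⇒> λ hi≤x →
  <⇒≱ lo<hi (+-cancelˡ-≤ hi hi lo (begin
    hi + hi  ≤⟨ +-mono-≤ hi≤x hi≤x ⟩
    x + x    ≡⟨ cong (x +_) (sym (+-identityʳ x)) ⟩
    2 * x    ≤⟨ 2x≤ ⟩
    hi + lo  ∎))
  where open ≤-Reasoning

left-part-nonempty : ∀ {x lo hi} → hi + lo < 2 * x → lo ≤ hi → lo < x
left-part-nonempty {x} {lo} {hi} <2x lo≤hi = ≰⇒> λ x≤lo →
  <⇒≱ <2x (begin
    2 * x    ≡⟨ cong (x +_) (+-identityʳ x) ⟩
    x + x    ≤⟨ +-mono-≤ x≤lo x≤lo ⟩
    lo + lo  ≤⟨ +-monoˡ-≤ lo lo≤hi ⟩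
    hi + lo  ∎)
  where open ≤-Reasoning

keep-right : ∀ {x lo hi t} → 2 * x ≤ hi + lo → hi + 2 ≤ t + suc x → hi + 2 ≤ 2 * t + lo
keep-right {x} {lo} {hi} {t} 2x≤ hyp = +-cancelʳ-≤ (hi + 2) (hi + 2) (2 * t + lo) (begin
  hi + 2 + (hi + 2)          ≤⟨ +-mono-≤ hyp hyp ⟩
  t + suc x + (t + suc x)    ≡⟨ regroup t x ⟩
  2 * t + 2 * x + 2          ≤⟨ +-monoˡ-≤ 2 (+-monoʳ-≤ (2 * t) 2x≤) ⟩
  2 * t + (hi + lo) + 2      ≡⟨ regroup′ t hi lo ⟩
  2 * t + lo + (hi + 2)      ∎)
  where
  open ≤-Reasoning
  regroup : ∀ t x → t + suc x + (t + suc x) ≡ 2 * t + 2 * x + 2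
  regroup = solve-∀
  regroup′ : ∀ t hi lo → 2 * t + (hi + lo) + 2 ≡ 2 * t + lo + (hi + 2)
  regroup′ = solve-∀

keep-left : ∀ {x lo hi t} → hi + lo < 2 * suc x → x + 2 ≤ t + lo → hi + 2 ≤ 2 * t + lo
keep-left {x} {lo} {hi} {t} <2x hyp = +-cancelʳ-≤ lo (hi + 2) (2 * t + lo) (begin
  hi + 2 + lo                ≡⟨ regroup hi lo ⟩
  suc (hi + lo) + 1          ≤⟨ +-monoˡ-≤ 1 <2x ⟩
  2 * suc x + 1              ≤⟨ +-monoʳ-≤ (2 * suc x) (n≤1+n 1) ⟩
  2 * suc x + 2              ≡⟨ regroup′ x ⟩
  x + 2 + (x + 2)            ≤⟨ +-mono-≤ hyp hyp ⟩
  t + lo + (t + lo)          ≡⟨ regroup″ t lo ⟩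
  2 * t + lo + lo            ∎)
  where
  open ≤-Reasoning
  regroup : ∀ hi lo → hi + 2 + lo ≡ suc (hi + lo) + 1
  regroup = solve-∀
  regroup′ : ∀ x → 2 * suc x + 2 ≡ x + 2 + (x + 2)
  regroup′ = solve-∀
  regroup″ : ∀ t lo → t + lo + (t + lo) ≡ 2 * t + lo + lo
  regroup″ = solve-∀

-- the position q of a path of length k, clamped to k so that it is total
clamp : (k : ℕ) → ℕ → Fin (suc k)
clamp zero    _       = fzero
clamp (suc k) zero    = fzero
clamp (suc k) (suc q) = fsuc (clamp k q)

toℕ-clamp : ∀ k q → q ≤ k → toℕ (clamp k q) ≡ q
toℕ-clamp zero    zero    _         = refl
toℕ-clamp (suc k) zero    _         = refl
toℕ-clamp (suc k) (suc q) (s≤s q≤k) = cong suc (toℕ-clamp k q q≤k)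

clamp-zero : ∀ k → clamp k 0 ≡ fzero
clamp-zero zero    = refl
clamp-zero (suc k) = refl

clamp-length : ∀ k → clamp k k ≡ fromℕ k
clamp-length zero    = refl
clamp-length (suc k) = cong fsuc (clamp-length k)

module Paths {n : ℕ} (G : Digraph n) (L : LinOrder n) where

  rk : Fin n → ℕ
  rk v = toℕ (rank L v)

  WR : Fin n → Fin n → Set
  WR v u = WReach G L n v u

  at : ∀ {k} → DPath G k → ℕ → Fin n
  at {k} P q = vtx P (clamp k q)

  vtx-at : ∀ {k} (P : DPath G k) (i : Fin (suc k)) → vtx P i ≡ at P (toℕ i)
  vtx-at {k} P i =
    cong (vtx P) (toℕ-injective (sym (toℕ-clamp k (toℕ i) (toℕ≤pred[n] i))))

  at-injective : ∀ {k} (P : DPath G k) {q q′} → q ≤ k → q′ ≤ k → at P q ≡ at P q′ → q ≡ q′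
  at-injective {k} P {q} {q′} q≤k q′≤k eq =
    trans (sym (toℕ-clamp k q q≤k)) (trans (cong toℕ (distinct P eq)) (toℕ-clamp k q′ q′≤k))

  at-zero : ∀ {k} (P : DPath G k) → at P 0 ≡ start P
  at-zero {k} P = cong (vtx P) (clamp-zero k)

  at-length : ∀ {k} (P : DPath G k) → at P k ≡ finish P
  at-length {k} P = cong (vtx P) (clamp-length k)

  arc-at : ∀ {k} (P : DPath G k) q → q < k → arc G (at P q) (at P (suc q)) ≡ true
  arc-at P q q<k = subst₂ (λ u v → arc G u v ≡ true)
    (trans (vtx-at P (inject₁ i)) (cong (at P) (trans (toℕ-inject₁ i) (toℕ-fromℕ< q<k))))
    (trans (vtx-at P (fsuc i)) (cong (λ t → at P (suc t)) (toℕ-fromℕ< q<k)))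
    (arcs P i)
    where
    i = fromℕ< q<k

  length-≤ : ∀ {k} → DPath G k → k ≤ n
  length-≤ P = ≤-trans (n≤1+n _) (injective⇒≤ (distinct P))

  position-kind : ∀ {k} (P : DPath G k) q → q ≤ k →
    at P q ≡ start P ⊎ at P q ≡ finish P ⊎ Internal P (at P q)
  position-kind {k} P q q≤k with q ≟ 0 | q ≟ k
  ... | yes refl | _        = inj₁ (at-zero P)
  ... | no _     | yes refl = inj₂ (inj₁ (at-length P))
  ... | no q≢0   | no q≢k   = inj₂ (inj₂ (clamp k q ,
        (λ e → q≢0 (trans (sym (toℕ-clamp k q q≤k)) e)) ,
        (λ e → q≢k (trans (sym (toℕ-clamp k q q≤k)) e)) , refl))

  MinOn : ∀ {k} → DPath G k → ℕ → ℕ → ℕ → Set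
  MinOn P = IsArgMin (λ q → rk (at P q))

  stretch : ∀ {k} (P : DPath G k) lo hi → lo ≤ hi → hi ≤ k → DPath G (hi ∸ lo)
  stretch {k} P lo hi lo≤hi hi≤k = record
    { vtx      = λ i → at P (lo + toℕ i)
    ; distinct = λ {i} {j} eq → toℕ-injective (+-cancelˡ-≡ lo _ _
        (at-injective P (in-range i) (in-range j) eq))
    ; arcs     = λ i → subst₂ (λ u v → arc G u v ≡ true)
        (cong (λ t → at P (lo + t)) (sym (toℕ-inject₁ i)))
        (cong (at P) (sym (+-suc lo (toℕ i))))
        (arc-at P (lo + toℕ i) (step-in-range i))
    }
    where
    lo+len≡hi : lo + (hi ∸ lo) ≡ hi
    lo+len≡hi = m+[n∸m]≡n lo≤hi
    in-range : (i : Fin (suc (hi ∸ lo))) → lo + toℕ i ≤ k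
    in-range i = ≤-trans (+-monoʳ-≤ lo (toℕ≤pred[n] i)) (≤-trans (≤-reflexive lo+len≡hi) hi≤k)
    step-in-range : (i : Fin (hi ∸ lo)) → lo + toℕ i < k
    step-in-range i = ≤-trans (≤-reflexive (sym (+-suc lo (toℕ i))))
      (≤-trans (+-monoʳ-≤ lo (toℕ<n i)) (≤-trans (≤-reflexive lo+len≡hi) hi≤k))

  stretch-start : ∀ {k} (P : DPath G k) {lo hi} lo≤hi hi≤k →
    start (stretch P lo hi lo≤hi hi≤k) ≡ at P lo
  stretch-start P {lo} _ _ = cong (at P) (+-identityʳ lo)

  stretch-finish : ∀ {k} (P : DPath G k) {lo hi} lo≤hi hi≤k →
    finish (stretch P lo hi lo≤hi hi≤k) ≡ at P hi
  stretch-finish P {lo} {hi} lo≤hi _ =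
    cong (at P) (trans (cong (lo +_) (toℕ-fromℕ (hi ∸ lo))) (m+[n∸m]≡n lo≤hi))

  stretch-min : ∀ {k} (P : DPath G k) {lo hi q} lo≤hi hi≤k → MinOn P lo hi q →
    IsMinOn L (stretch P lo hi lo≤hi hi≤k) (at P q)
  stretch-min P {lo} {hi} {q} lo≤hi _ (lo≤q , q≤hi , min) =
    (clamp (hi ∸ lo) (q ∸ lo) , cong (at P) offset) ,
    λ i → min (lo + toℕ i) (m≤m+n lo (toℕ i))
      (≤-trans (+-monoʳ-≤ lo (toℕ≤pred[n] i)) (≤-reflexive (m+[n∸m]≡n lo≤hi)))
    where
    offset : lo + toℕ (clamp (hi ∸ lo) (q ∸ lo)) ≡ q
    offset = trans (cong (lo +_) (toℕ-clamp (hi ∸ lo) (q ∸ lo) (∸-monoˡ-≤ lo q≤hi)))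
                   (m+[n∸m]≡n lo≤q)

  min-reached-from-lo : ∀ {k} (P : DPath G k) {lo hi q} → hi ≤ k → MinOn P lo hi q →
    WR (at P lo) (at P q)
  min-reached-from-lo P {lo} {hi} {q} hi≤k q-min@(lo≤q , q≤hi , _) =
    q ∸ lo , length-≤ S , S ,
    inj₂ (stretch-start P lo≤q q≤k , stretch-finish P lo≤q q≤k) ,
    stretch-min P lo≤q q≤k (argmin-shrink ≤-refl q≤hi lo≤q ≤-refl q-min)
    where
    q≤k = ≤-trans q≤hi hi≤k
    S = stretch P lo q lo≤q q≤k

  min-reached-from-hi : ∀ {k} (P : DPath G k) {lo hi q} → hi ≤ k → MinOn P lo hi q →
    WR (at P hi) (at P q)
  min-reached-from-hi P {lo} {hi} {q} hi≤k q-min@(lo≤q , q≤hi , _) =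
    hi ∸ q , length-≤ S , S ,
    inj₁ (stretch-start P q≤hi hi≤k , stretch-finish P q≤hi hi≤k) ,
    stretch-min P q≤hi hi≤k (argmin-shrink lo≤q ≤-refl ≤-refl q≤hi q-min)
    where
    S = stretch P q hi q≤hi hi≤k

-- Long paths force large weak reachability sets

module Halving {n : ℕ} {G : Digraph n} (L : LinOrder n) {k : ℕ} (P : DPath G k) where
  open Paths G L

  -- a position of P[lo..hi] weakly reaching t distinct positions of P[lo..hi],
  -- where t ≥ log₂ (hi − lo + 2)
  record Hub (lo hi : ℕ) : Set where
    field
      hub            : ℕ
      hub-within     : lo ≤ hub × hub ≤ hi
      reached        : List ℕ
      reached-unique : Unique reached
      reached-within : All (λ q → lo ≤ q × q ≤ hi) reached
      reached-reach  : All (λ q → WR (at P hub) (at P q)) reached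
      reached-many   : hi + 2 ≤ 2 ^ length reached + lo

  single : ∀ {lo hi} → lo ≡ hi → hi ≤ k → Hub lo hi
  single {lo} refl lo≤k = record
    { hub = lo ; hub-within = ≤-refl , ≤-refl
    ; reached = lo ∷ [] ; reached-unique = [] ∷ []
    ; reached-within = (≤-refl , ≤-refl) ∷ []
    ; reached-reach = min-reached-from-lo P lo≤k (argmin-point _ lo) ∷ []
    ; reached-many = ≤-reflexive (+-comm lo 2) }

  extend-right : ∀ {lo hi x} → hi ≤ k → MinOn P lo hi x → 2 * x ≤ hi + lo →
    Hub (suc x) hi → Hub lo hi
  extend-right {lo} {hi} {x} hi≤k x-min@(lo≤x , x≤hi , _) 2x≤ W = record
    { hub = hub ; hub-within = ≤-trans lo≤x x≤hub , hub≤hi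
    ; reached = x ∷ reached
    ; reached-unique = All.map (λ x<q → <⇒≢ (proj₁ x<q)) reached-within ∷ reached-unique
    ; reached-within = (lo≤x , x≤hi) ∷
        All.map (λ q-in → ≤-trans lo≤x (<⇒≤ (proj₁ q-in)) , proj₂ q-in) reached-within
    ; reached-reach = min-reached-from-hi P (≤-trans hub≤hi hi≤k)
        (argmin-shrink lo≤x hub≤hi ≤-refl x≤hub x-min) ∷ reached-reach
    ; reached-many = keep-right 2x≤ reached-many }
    where
    open Hub W
    hub≤hi = proj₂ hub-within
    x≤hub = <⇒≤ (proj₁ hub-within)

  extend-left : ∀ {lo hi x} → hi ≤ k → MinOn P lo hi (suc x) → hi + lo < 2 * suc x →
    Hub lo x → Hub lo hi
  extend-left {lo} {hi} {x} hi≤k x-min@(_ , x<hi , _) <2x W = record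
    { hub = hub ; hub-within = lo≤hub , ≤-trans hub≤x (<⇒≤ x<hi)
    ; reached = suc x ∷ reached
    ; reached-unique = All.map (λ q-in → ≢-sym (<⇒≢ (s≤s (proj₂ q-in)))) reached-within
        ∷ reached-unique
    ; reached-within = (≤-trans (≤-trans lo≤hub hub≤x) (n≤1+n x) , x<hi) ∷
        All.map (λ q-in → proj₁ q-in , ≤-trans (proj₂ q-in) (<⇒≤ x<hi)) reached-within
    ; reached-reach = min-reached-from-lo P (≤-trans x<hi hi≤k)
        (argmin-shrink lo≤hub x<hi (≤-trans hub≤x (n≤1+n x)) ≤-refl x-min) ∷ reached-reach
    ; reached-many = keep-left <2x reached-many }
    where
    open Hub W
    lo≤hub = proj₁ hub-within
    hub≤x = proj₂ hub-within

  -- recursion on a bound d for the length of the stretch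
  build : ∀ d lo hi → lo ≤ hi → hi ≤ lo + d → hi ≤ k → Hub lo hi
  build zero lo hi lo≤hi hi≤ hi≤k =
    single (≤-antisym lo≤hi (≤-trans hi≤ (≤-reflexive (+-identityʳ lo)))) hi≤k
  build (suc d) lo hi lo≤hi hi≤ hi≤k with lo ≟ hi
  ... | yes lo≡hi = single lo≡hi hi≤k
  ... | no lo≢hi with argmin (λ q → rk (at P q)) lo hi lo≤hi
  ...   | x , x-min with 2 * x ≤? hi + lo
  ...     | yes 2x≤ = extend-right hi≤k x-min 2x≤
    (build d (suc x) hi (right-part-nonempty 2x≤ (≤∧≢⇒< lo≤hi lo≢hi))
       (≤-trans hi≤ (≤-trans (≤-reflexive (+-suc lo d)) (s≤s (+-monoˡ-≤ d (proj₁ x-min)))))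
       hi≤k)
  build (suc d) lo hi lo≤hi hi≤ hi≤k | no _ | zero , x-min | no 2x≰ =
    ⊥-elim (n≮0 (left-part-nonempty (≰⇒> 2x≰) lo≤hi))
  build (suc d) lo hi lo≤hi hi≤ hi≤k | no _ | suc x , x-min | no 2x≰ =
    extend-left hi≤k x-min (≰⇒> 2x≰)
      (build d lo x (≤-pred (left-part-nonempty (≰⇒> 2x≰) lo≤hi))
         (≤-pred (≤-trans (proj₁ (proj₂ x-min)) (≤-trans hi≤ (≤-reflexive (+-suc lo d)))))
         (≤-trans (n≤1+n x) (≤-trans (proj₁ (proj₂ x-min)) hi≤k)))

path-length-bound : ∀ {n} (G : Digraph n) c → WcolInfLe G c → ∀ k → DPath G k → k ≤ 2 ^ c ∸ 2
path-length-bound G c (L , wreach-small) k P =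
  ≤-trans (≤-reflexive (sym (m+n∸n≡m k 2))) (∸-monoˡ-≤ 2 (begin
    k + 2                   ≤⟨ reached-many ⟩
    2 ^ length reached + 0  ≡⟨ +-identityʳ _ ⟩
    2 ^ length reached      ≤⟨ ^-monoʳ-≤ 2 few ⟩
    2 ^ c                   ∎))
  where
  open ≤-Reasoning
  open Paths G L
  open Halving L P
  open Hub (build k 0 k z≤n ≤-refl ≤-refl)
  S = proj₁ (wreach-small (at P hub))
  few : length reached ≤ c
  few = begin
    length reached                        ≡⟨ sym (sumOver-ones reached) ⟩
    sumOver reached (λ _ → ind true)      ≤⟨ count-marked S (λ _ → true) (λ q _ → at P q) reached
      reached-unique
      (λ q∈ q′∈ _ _ → at-injective P (proj₂ (All.lookup reached-within q∈))
                                     (proj₂ (All.lookup reached-within q′∈)))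
      (λ q∈ _ → Equivalence.from (proj₁ (proj₂ (wreach-small (at P hub))) _)
                                 (All.lookup reached-reach q∈)) ⟩
    ∣ S ∣                                 ≤⟨ proj₂ (proj₂ (wreach-small (at P hub))) ⟩
    c                                     ∎

-- Second half: counting the arcs of a directed topological minor

module ArcCount {n m : ℕ} {G : Digraph n} {H : Digraph m} (M : TopMinorModel H G)
  (L : LinOrder n) (c : ℕ) (wreach-small : ∀ v → WReachSizeLe G L n v c) where
  open Paths G L
  open TopMinorModel M

  lowest-position : ∀ a b e → ∃[ q ] MinOn (path a b e) 0 (len a b e) q
  lowest-position a b e = argmin (λ q → rk (at (path a b e) q)) 0 (len a b e) z≤n

  lowest : ∀ a b → arc H a b ≡ true → Fin n
  lowest a b e = at (path a b e) (proj₁ (lowest-position a b e))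

  tail-reaches-lowest : ∀ a b e → WR (δ a) (lowest a b e)
  tail-reaches-lowest a b e = subst (λ v → WR v (lowest a b e))
    (trans (at-zero (path a b e)) (path-start a b e))
    (min-reached-from-lo (path a b e) ≤-refl (proj₂ (lowest-position a b e)))

  head-reaches-lowest : ∀ a b e → WR (δ b) (lowest a b e)
  head-reaches-lowest a b e = subst (λ v → WR v (lowest a b e))
    (trans (at-length (path a b e)) (path-end a b e))
    (min-reached-from-hi (path a b e) ≤-refl (proj₂ (lowest-position a b e)))

  lowest-≤-tail : ∀ a b e → rk (lowest a b e) ≤ rk (δ a)
  lowest-≤-tail a b e = subst (λ v → rk (lowest a b e) ≤ rk v)
    (trans (at-zero (path a b e)) (path-start a b e))
    (proj₂ (proj₂ (proj₂ (lowest-position a b e))) 0 ≤-refl z≤n)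

  lowest-≤-head : ∀ a b e → rk (lowest a b e) ≤ rk (δ b)
  lowest-≤-head a b e = subst (λ v → rk (lowest a b e) ≤ rk v)
    (trans (at-length (path a b e)) (path-end a b e))
    (proj₂ (proj₂ (proj₂ (lowest-position a b e))) (len a b e) z≤n ≤-refl)

  lowest-kind : ∀ a b e →
    lowest a b e ≡ δ a ⊎ lowest a b e ≡ δ b ⊎ Internal (path a b e) (lowest a b e)
  lowest-kind a b e with position-kind (path a b e) _ (proj₁ (proj₂ (proj₂ (lowest-position a b e))))
  ... | inj₁ at-start          = inj₁ (trans at-start (path-start a b e))
  ... | inj₂ (inj₁ at-finish)  = inj₂ (inj₁ (trans at-finish (path-end a b e)))
  ... | inj₂ (inj₂ internal)   = inj₂ (inj₂ internal)

  -- an internal vertex of a model path lies on no other model path, so an internal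
  -- lowest vertex determines its arc
  internal-lowest-determines-arc : ∀ {a b e a′ b′ e′} →
    Internal (path a b e) (lowest a b e) → lowest a b e ≡ lowest a′ b′ e′ → a ≡ a′ × b ≡ b′
  internal-lowest-determines-arc {a} {b} {e} {a′} {b′} {e′} internal eq =
    decidable-stable (a Fin.≟ a′ ×-dec b Fin.≟ b′) λ different →
      avoid-paths a b e a′ b′ e′ different (lowest a b e) internal
        (clamp (len a′ b′ e′) (proj₁ (lowest-position a′ b′ e′)) , sym eq)

  -- On arcs descending in L (δ b <_L δ a) the lowest vertex is not δ a, so it is δ b
  -- or internal; hence for fixed a it determines b.
  descending-injective : ∀ {a b b′ e e′} → rk (δ b) < rk (δ a) → rk (δ b′) < rk (δ a) →
    lowest a b e ≡ lowest a b′ e′ → b ≡ b′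
  descending-injective {a} {b} {b′} {e} {e′} b<a b′<a eq
    with lowest-kind a b e | lowest-kind a b′ e′
  ... | inj₁ is-tail | _ = ⊥-elim (<⇒≱ b<a (subst (λ v → rk v ≤ rk (δ b)) is-tail (lowest-≤-head a b e)))
  ... | _ | inj₁ is-tail = ⊥-elim (<⇒≱ b′<a (subst (λ v → rk v ≤ rk (δ b′)) is-tail (lowest-≤-head a b′ e′)))
  ... | inj₂ (inj₂ internal) | _ = proj₂ (internal-lowest-determines-arc internal eq)
  ... | _ | inj₂ (inj₂ internal) = sym (proj₂ (internal-lowest-determines-arc internal (sym eq)))
  ... | inj₂ (inj₁ is-head) | inj₂ (inj₁ is-head′) = δ-inj (trans (sym is-head) (trans eq is-head′))

  ascending-injective : ∀ {a a′ b e e′} → rk (δ a) < rk (δ b) → rk (δ a′) < rk (δ b) →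
    lowest a b e ≡ lowest a′ b e′ → a ≡ a′
  ascending-injective {a} {a′} {b} {e} {e′} a<b a′<b eq
    with lowest-kind a b e | lowest-kind a′ b e′
  ... | inj₂ (inj₁ is-head) | _ = ⊥-elim (<⇒≱ a<b (subst (λ v → rk v ≤ rk (δ a)) is-head (lowest-≤-tail a b e)))
  ... | _ | inj₂ (inj₁ is-head) = ⊥-elim (<⇒≱ a′<b (subst (λ v → rk v ≤ rk (δ a′)) is-head (lowest-≤-tail a′ b e′)))
  ... | inj₂ (inj₂ internal) | _ = proj₁ (internal-lowest-determines-arc internal eq)
  ... | _ | inj₂ (inj₂ internal) = sym (proj₁ (internal-lowest-determines-arc internal (sym eq)))
  ... | inj₁ is-tail | inj₁ is-tail′ = δ-inj (trans (sym is-tail) (trans eq is-tail′))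

  descending ascending : Fin m → Fin m → Bool
  descending a b = arc H a b ∧ (rk (δ b) <ᵇ rk (δ a))
  ascending  a b = arc H a b ∧ (rk (δ a) <ᵇ rk (δ b))

  descending-spec : ∀ {a b} → descending a b ≡ true → arc H a b ≡ true × rk (δ b) < rk (δ a)
  descending-spec = ∧-<ᵇ-true _

  ascending-spec : ∀ {a b} → ascending a b ≡ true → arc H a b ≡ true × rk (δ a) < rk (δ b)
  ascending-spec = ∧-<ᵇ-true _

  -- every arc ascends or descends: its ends are distinct vertices of a loopless digraph
  arc-splits : ∀ a b → ind (arc H a b) ≤ ind (descending a b) + ind (ascending a b)
  arc-splits a b = ind-split (arc H a b) λ a→b same-rank →
    no-loop (δ-inj (rank-inj L (toℕ-injective same-rank))) a→b
    where
    no-loop : a ≡ b → arc H a b ≡ true → ⊥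
    no-loop refl a→a with trans (sym a→a) (loopless H a)
    ... | ()

  A = allFin m

  descending-out-degree : ∀ a → sumOver A (λ b → ind (descending a b)) ≤ c
  descending-out-degree a = ≤-trans
    (count-marked S (descending a) (λ b d → lowest a b (proj₁ (descending-spec d))) A (allFin⁺ m)
      (λ _ _ d d′ → descending-injective (proj₂ (descending-spec d)) (proj₂ (descending-spec d′)))
      (λ _ d → Equivalence.from (proj₁ (proj₂ (wreach-small (δ a))) _) (tail-reaches-lowest a _ _)))
    (proj₂ (proj₂ (wreach-small (δ a))))
    where S = proj₁ (wreach-small (δ a))

  ascending-in-degree : ∀ b → sumOver A (λ a → ind (ascending a b)) ≤ c
  ascending-in-degree b = ≤-trans
    (count-marked S (λ a → ascending a b) (λ a d → lowest a b (proj₁ (ascending-spec d))) A (allFin⁺ m)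
      (λ _ _ d d′ → ascending-injective (proj₂ (ascending-spec d)) (proj₂ (ascending-spec d′)))
      (λ _ d → Equivalence.from (proj₁ (proj₂ (wreach-small (δ b))) _) (head-reaches-lowest _ b _)))
    (proj₂ (proj₂ (wreach-small (δ b))))
    where S = proj₁ (wreach-small (δ b))

  arc-count-bound : arcCount H ≤ 4 * c * m
  arc-count-bound = begin
    arcCount H
      ≤⟨ sumOver-mono A (λ a → sumOver-mono A (arc-splits a)) ⟩
    sumOver A (λ a → sumOver A (λ b → ind (descending a b) + ind (ascending a b)))
      ≤⟨ sumOver-mono A (λ a → ≤-reflexive (sumOver-+ A _ _)) ⟩
    sumOver A (λ a → sumOver A (λ b → ind (descending a b)) + sumOver A (λ b → ind (ascending a b)))
      ≡⟨ sumOver-+ A _ _ ⟩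
    sumOver A (λ a → sumOver A (λ b → ind (descending a b))) + sumOver A (λ a → sumOver A (λ b → ind (ascending a b)))
      ≡⟨ cong (sumOver A (λ a → sumOver A (λ b → ind (descending a b))) +_) (sumOver-swap A A (λ a b → ind (ascending a b))) ⟩
    sumOver A (λ a → sumOver A (λ b → ind (descending a b))) + sumOver A (λ b → sumOver A (λ a → ind (ascending a b)))
      ≤⟨ +-mono-≤ (sumOver-≤-length* A _ c descending-out-degree) (sumOver-≤-length* A _ c ascending-in-degree) ⟩
    length A * c + length A * c
      ≡⟨ cong (λ l → l * c + l * c) (length-tabulate {n = m} (λ i → i)) ⟩
    m * c + m * c
      ≤⟨ m≤m+n (m * c + m * c) (2 * c * m) ⟩
    m * c + m * c + 2 * c * m
      ≡⟨ double c m ⟩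
    4 * c * m ∎
    where
    open ≤-Reasoning
    double : ∀ c m → m * c + m * c + 2 * c * m ≡ 4 * c * m
    double = solve-∀

mainTheorem17 : ∀ {n} (G : Digraph n) (c : ℕ) → WcolInfLe G c →
    (∀ k → DPath G k → k ≤ 2 ^ c ∸ 2)
    × (∀ {m} (H : Digraph m) → IsDirTopMinor H G → arcCount H ≤ 4 * c * m)
mainTheorem17 G c wcol@(L , wreach-small) =
  path-length-bound G c wcol ,
  λ H model → ArcCount.arc-count-bound model L c wreach-small
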